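{- Let $d_1,\dots,d_s$ be positive integers and $D=\operatorname{lcm}(d_1,\dots,d_s)$. Then $$I(d_1,\dots,d_s)=\frac{(-1)^s}{D}\sum_{m=1}^{D}\prod_{i:\,d_i\mid m}(1-d_i).$$
   Context: $I(d_1,\dots,d_s)$ denotes the number of $s$-tuples of integers $(y_1,\dots,y_s)$ with $1\le y_i\le d_i-1$ for all $i$ such that $\frac{y_1}{d_1}+\cdots+\frac{y_s}{d_s}\equiv 0\pmod 1$. An empty product equals $1$. -}

module Defs where

open import Data.Nat as ℕ using (ℕ; zero; suc; _≟_)
open import Data.Nat.LCM using (lcm)
open import Data.Nat.Divisibility using (_∣?_)
open import Data.Integer as ℤ using (ℤ; +_)
open import Data.Rational as ℚ using (ℚ)
open import Data.List using (List; []; _∷_; map; concatMap; filter; length; upTo; product; sum)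
open import Data.Vec as Vec using (Vec; []; _∷_)
open import Relation.Nullary.Decidable using (does)
open import Data.Bool using (if_then_else_)

-- The rational a / d (with d ≥ 1 in all uses; the d = 0 branch is unused junk).
divZ : ℤ → ℕ → ℚ
divZ a zero    = ℚ.0ℚ
divZ a (suc k) = a ℚ./ suc k

frac : ℕ → ℕ → ℚ
frac y d = divZ (+ y) d

range : ℕ → List ℕ
range d = map suc (upTo (d ℕ.∸ 1))

tuples : ∀ {s} → Vec ℕ s → List (Vec ℕ s)
tuples []       = [] ∷ []
tuples (d ∷ ds) = concatMap (λ y → map (y ∷_) (tuples ds)) (range d)

fracSum : ∀ {s} → Vec ℕ s → Vec ℕ s → ℚ
fracSum []       []       = ℚ.0ℚ
fracSum (d ∷ ds) (y ∷ ys) = frac y d ℚ.+ fracSum ds ys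

I : ∀ {s} → Vec ℕ s → ℕ
I {s} ds = length (filter (λ ys → ℚ.denominatorℕ (fracSum ds ys) ≟ 1) (tuples ds))

lcmV : ∀ {s} → Vec ℕ s → ℕ
lcmV = Vec.foldr _ lcm 1

prodDiv : ∀ {s} → Vec ℕ s → ℕ → ℤ
prodDiv []       m = ℤ.1ℤ
prodDiv (d ∷ ds) m =
  (if does (d ∣? m) then (ℤ.1ℤ ℤ.- + d) else ℤ.1ℤ) ℤ.* prodDiv ds m

sumProd : ∀ {s} → Vec ℕ s → ℤ
sumProd ds = Data.List.foldr ℤ._+_ ℤ.0ℤ (map (λ m → prodDiv ds (suc m)) (upTo (lcmV ds)))

rhs : ∀ {s} → Vec ℕ s → ℚ
rhs {s} ds = divZ (ℤ.-1ℤ ℤ.^ s) (lcmV ds) ℚ.* (sumProd ds ℚ./ 1)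

{-# OPTIONS --safe #-}
-- Put M = lcm(d_i) and a_i = M/d_i, so that (y_i) is counted by I exactly when M ∣ ∑ y_i a_i.
-- Dropping the condition y_i ≠ 0 coordinate by coordinate writes I as an alternating sum, over
-- the sublists T of the d_i, of the number of tuples with 0 ≤ y_i < d_i (i ∈ T) and
-- M ∣ ∑ y_i a_i. That number is (∏_{i∈T} d_i)·g_T/M with g_T = gcd(M, a_i : i ∈ T), since the
-- sums ∑ y_i a_i run equally often through the multiples of g_T modulo M. On the other side,
-- (-1)^s ∏_{d_i∣m} (1 - d_i) = ∏_i (𝟙[d_i∣m]·d_i - 1) expands into the same alternating sum of
-- ∏_{i∈T} d_i·𝟙[d_i ∣ m for i ∈ T], and summing over 1 ≤ m ≤ M counts g_T such m.
module Submission where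

open import Data.Bool using (if_then_else_)
open import Data.Empty using (⊥-elim)
open import Data.Integer using (ℤ; +_)
import Data.Integer as ℤ
import Data.Integer.GCD as ℤ
import Data.Integer.Properties as ℤ
open import Data.Integer.Tactic.RingSolver using () renaming (solve-∀ to solveℤ-∀)
open import Data.List using (List; []; _∷_; [_]; _++_; length; filter; map; concatMap; applyUpTo; upTo; foldr)
open import Data.List.Properties using (filter-++; filter-≐; length-++; concatMap-map)
open import Data.List.Relation.Unary.All using () renaming (All to ListAll; [] to []ᴬ; _∷_ to _∷ᴬ_)
open import Data.Nat as ℕ using (ℕ; zero; suc; _+_; _*_; _∸_; _≤_; _<_; z≤n; s≤s; NonZero; ≢-nonZero; ≢-nonZero⁻¹)
open import Data.Nat.DivMod using (m*[n/m]≡n)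
open import Data.Nat.Divisibility
open import Data.Nat.GCD
open import Data.Nat.LCM using (lcm; gcd*lcm; m∣lcm[m,n]; n∣lcm[m,n])
open import Data.Nat.ListAction using (product)
open import Data.Nat.Properties
open import Data.Nat.Tactic.RingSolver using (solve-∀)
open import Data.Product using (_,_)
open import Data.Rational using (ℚ; _/_)
import Data.Rational as ℚ
import Data.Rational.Properties as ℚ
open import Data.Rational.Unnormalised as ℚᵘ using (mkℚᵘ; *≡*)
import Data.Rational.Unnormalised.Properties as ℚᵘ
open import Data.Sum using (inj₁; inj₂)
open import Data.Unit using (⊤)
open import Data.Vec using (Vec; []; _∷_; lookup)
open import Data.Vec.Relation.Unary.All as All using (All; []; _∷_)
open import Data.Vec.Relation.Unary.All.Properties using (lookup⁻)
open import Function using (_∘_)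
open import Level using (0ℓ)
open import Relation.Binary.PropositionalEquality hiding ([_])
open import Relation.Nullary using (Dec; yes; no; ¬_; does)
open import Relation.Nullary.Decidable using (recompute)
open import Relation.Unary using (Pred; Decidable; _≐_)

open import Defs

-- Indicators and finite sums

𝟙 : {P : Set} → Dec P → ℕ
𝟙 (yes _) = 1
𝟙 (no _)  = 0

𝟙-yes : {P : Set} (dp : Dec P) → P → 𝟙 dp ≡ 1
𝟙-yes (yes _) _ = refl
𝟙-yes (no ¬p) p = ⊥-elim (¬p p)

𝟙-no : {P : Set} (dp : Dec P) → ¬ P → 𝟙 dp ≡ 0
𝟙-no (yes p) ¬p = ⊥-elim (¬p p)
𝟙-no (no _)  _  = refl

𝟙-cong : {P Q : Set} (dp : Dec P) (dq : Dec Q) → (P → Q) → (Q → P) → 𝟙 dp ≡ 𝟙 dq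
𝟙-cong (yes p) dq f g = sym (𝟙-yes dq (f p))
𝟙-cong (no ¬p) dq f g = sym (𝟙-no dq (¬p ∘ g))

𝟙-× : {P Q R : Set} (dp : Dec P) (dq : Dec Q) (dr : Dec R) →
      (P → Q → R) → (R → P) → (R → Q) → 𝟙 dp * 𝟙 dq ≡ 𝟙 dr
𝟙-× (yes p) (yes q) dr f g h = sym (𝟙-yes dr (f p q))
𝟙-× (yes p) (no ¬q) dr f g h = sym (𝟙-no dr (¬q ∘ h))
𝟙-× (no ¬p) dq      dr f g h = sym (𝟙-no dr (¬p ∘ g))

𝟙-∣-+ˡ : ∀ {q m} j → q ∣ m → 𝟙 (q ∣? m + j) ≡ 𝟙 (q ∣? j)
𝟙-∣-+ˡ j q∣m = 𝟙-cong (_ ∣? _) (_ ∣? j) (λ q∣m+j → ∣m+n∣m⇒∣n q∣m+j q∣m) (∣m∣n⇒∣m+n q∣m)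

𝟙-∣-+ʳ : ∀ {q m} j → q ∣ m → 𝟙 (q ∣? j + m) ≡ 𝟙 (q ∣? j)
𝟙-∣-+ʳ {q} {m} j q∣m = trans (cong (𝟙 ∘ (q ∣?_)) (+-comm j m)) (𝟙-∣-+ˡ j q∣m)

∣m+n∣n⇒∣m : ∀ {d m n} → d ∣ m + n → d ∣ n → d ∣ m
∣m+n∣n⇒∣m {d} {m} {n} d∣m+n = ∣m+n∣m⇒∣n (subst (d ∣_) (+-comm m n) d∣m+n)

∑ : ℕ → (ℕ → ℕ) → ℕ
∑ zero    f = 0
∑ (suc n) f = f 0 + ∑ n (f ∘ suc)

infix 5 ∑
syntax ∑ n (λ j → e) = ∑[ j < n ] e

∑-cong : ∀ n {f g : ℕ → ℕ} → (∀ j → j < n → f j ≡ g j) → ∑ n f ≡ ∑ n g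
∑-cong zero    eq = refl
∑-cong (suc n) eq = cong₂ _+_ (eq 0 (s≤s z≤n)) (∑-cong n (λ j j<n → eq (suc j) (s≤s j<n)))

∑-zero : ∀ n {f : ℕ → ℕ} → (∀ j → j < n → f j ≡ 0) → ∑ n f ≡ 0
∑-zero zero    eq = refl
∑-zero (suc n) eq = cong₂ _+_ (eq 0 (s≤s z≤n)) (∑-zero n (λ j j<n → eq (suc j) (s≤s j<n)))

∑-1 : ∀ n → ∑[ _ < n ] 1 ≡ n
∑-1 zero    = refl
∑-1 (suc n) = cong suc (∑-1 n)

∑-distrib-+ : ∀ n (f g : ℕ → ℕ) → ∑[ j < n ] (f j + g j) ≡ ∑ n f + ∑ n g
∑-distrib-+ zero    f g = refl
∑-distrib-+ (suc n) f g = begin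
  (f 0 + g 0) + (∑[ j < n ] f (suc j) + g (suc j)) ≡⟨ cong (_+_ (f 0 + g 0)) (∑-distrib-+ n (f ∘ suc) (g ∘ suc)) ⟩
  (f 0 + g 0) + (∑ n (f ∘ suc) + ∑ n (g ∘ suc))    ≡⟨ +-exchange (f 0) (g 0) _ _ ⟩
  (f 0 + ∑ n (f ∘ suc)) + (g 0 + ∑ n (g ∘ suc))    ∎
  where
  open ≡-Reasoning
  +-exchange : ∀ a b c d → (a + b) + (c + d) ≡ (a + c) + (b + d)
  +-exchange = solve-∀

∑-distribʳ-* : ∀ n (f : ℕ → ℕ) c → ∑[ j < n ] (f j * c) ≡ ∑ n f * c
∑-distribʳ-* zero    f c = refl
∑-distribʳ-* (suc n) f c =
  trans (cong (_+_ (f 0 * c)) (∑-distribʳ-* n (f ∘ suc) c)) (sym (*-distribʳ-+ c (f 0) _))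

∑-comm : ∀ m n (f : ℕ → ℕ → ℕ) → ∑[ i < m ] ∑[ j < n ] f i j ≡ ∑[ j < n ] ∑[ i < m ] f i j
∑-comm zero    n f = sym (∑-zero n (λ _ _ → refl))
∑-comm (suc m) n f =
  trans (cong (_+_ (∑ n (f 0))) (∑-comm m n (f ∘ suc)))
        (sym (∑-distrib-+ n (f 0) (λ j → ∑[ i < m ] f (suc i) j)))

∑-split : ∀ m n (f : ℕ → ℕ) → ∑ (m + n) f ≡ ∑ m f + (∑[ j < n ] f (m + j))
∑-split zero    n f = refl
∑-split (suc m) n f = trans (cong (_+_ (f 0)) (∑-split m n (f ∘ suc))) (sym (+-assoc (f 0) _ _))

∑-rotate : ∀ n (f : ℕ → ℕ) → (∑[ j < n ] f (suc j)) + f 0 ≡ ∑ n f + f n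
∑-rotate zero    f = refl
∑-rotate (suc n) f = begin
  (f 1 + ∑ n (f ∘ suc ∘ suc)) + f 0 ≡⟨ rearrange (f 1) _ (f 0) ⟩
  f 0 + (∑ n (f ∘ suc ∘ suc) + f 1) ≡⟨ cong (_+_ (f 0)) (∑-rotate n (f ∘ suc)) ⟩
  f 0 + (∑ n (f ∘ suc) + f (suc n)) ≡⟨ +-assoc (f 0) _ _ ⟨
  (f 0 + ∑ n (f ∘ suc)) + f (suc n) ∎
  where
  open ≡-Reasoning
  rearrange : ∀ a b c → (a + b) + c ≡ c + (b + a)
  rearrange = solve-∀

∑-periodic : ∀ n (f : ℕ → ℕ) → f n ≡ f 0 → ∑[ j < n ] f (suc j) ≡ ∑ n f
∑-periodic n f fn≡f0 = +-cancelʳ-≡ (f 0) _ _ (trans (∑-rotate n f) (cong (_+_ (∑ n f)) fn≡f0))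

∑𝟙-∣-initial : ∀ q .{{_ : NonZero q}} → ∑[ t < q ] 𝟙 (q ∣? t) ≡ 1
∑𝟙-∣-initial (suc r) = cong₂ _+_ (𝟙-yes (suc r ∣? 0) (suc r ∣0))
  (∑-zero r (λ j j<r → 𝟙-no (suc r ∣? suc j) (λ q∣1+j → <⇒≱ (s≤s j<r) (∣⇒≤ q∣1+j))))

∑𝟙-∣-multiples : ∀ k q .{{_ : NonZero q}} → ∑[ t < k * q ] 𝟙 (q ∣? t) ≡ k
∑𝟙-∣-multiples zero    q = refl
∑𝟙-∣-multiples (suc k) q = trans (∑-split q (k * q) _)
  (cong₂ _+_ (∑𝟙-∣-initial q)
    (trans (∑-cong (k * q) (λ j _ → 𝟙-∣-+ˡ j ∣-refl)) (∑𝟙-∣-multiples k q)))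

∑𝟙-∣-window : ∀ q .{{_ : NonZero q}} x → ∑[ t < q ] 𝟙 (q ∣? t + x) ≡ 1
∑𝟙-∣-window q zero = trans (∑-cong q (λ t _ → cong (𝟙 ∘ (q ∣?_)) (+-identityʳ t))) (∑𝟙-∣-initial q)
∑𝟙-∣-window q (suc x) =
  trans (∑-cong q (λ t _ → cong (𝟙 ∘ (q ∣?_)) (+-suc t x)))
        (trans (∑-periodic q (λ t → 𝟙 (q ∣? t + x)) (𝟙-∣-+ˡ x ∣-refl)) (∑𝟙-∣-window q x))

Periodic : ℕ → (ℕ → ℕ) → Set
Periodic p f = ∀ t → f (t + p) ≡ f t

periodic-* : ∀ {p f} → Periodic p f → ∀ k t → f (t + k * p) ≡ f t
periodic-* {p} {f} per zero    t = cong f (+-identityʳ t)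
periodic-* {p} {f} per (suc k) t =
  trans (cong f (+-swap t p (k * p))) (trans (per (t + k * p)) (periodic-* per k t))
  where
  +-swap : ∀ t a b → t + (a + b) ≡ t + b + a
  +-swap = solve-∀

periodic-∣ : ∀ {p f t} → Periodic p f → p ∣ t → f t ≡ f 0
periodic-∣ per (divides k refl) = periodic-* per k 0

periodic-gcd : ∀ {a b f} → Periodic a f → Periodic b f → Periodic (gcd a b) f
periodic-gcd {a} {b} {f} per-a per-b t with Bézout.identity (gcd-GCD a b)
... | Bézout.+- x y h+yb≡xa = begin
  f (t + gcd a b)         ≡⟨ periodic-* per-b y (t + gcd a b) ⟨
  f (t + gcd a b + y * b) ≡⟨ cong f (trans (+-assoc t _ _) (cong (_+_ t) h+yb≡xa)) ⟩
  f (t + x * a)           ≡⟨ periodic-* per-a x t ⟩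
  f t                     ∎
  where open ≡-Reasoning
... | Bézout.-+ x y h+xa≡yb = begin
  f (t + gcd a b)         ≡⟨ periodic-* per-a x (t + gcd a b) ⟨
  f (t + gcd a b + x * a) ≡⟨ cong f (trans (+-assoc t _ _) (cong (_+_ t) h+xa≡yb)) ⟩
  f (t + y * b)           ≡⟨ periodic-* per-b y t ⟩
  f t                     ∎
  where open ≡-Reasoning

-- Counting solutions of an affine congruence

countAffine : ℕ → ℕ → ℕ → ℕ → ℕ
countAffine n a g t = ∑[ j < n ] 𝟙 (g ∣? t + j * a)

-- c = countAffine n a g has periods a and g, hence gcd a g (Bézout); it vanishes off the
-- multiples of gcd a g, and ∑_{t<g} c t = n since each j < n hits exactly one t.
module _ (n a g : ℕ) .{{_ : NonZero g}} (g∣na : g ∣ n * a) where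

  private
    c : ℕ → ℕ
    c = countAffine n a g

    h : ℕ
    h = gcd a g

    instance
      h-nonZero : NonZero h
      h-nonZero = ≢-nonZero (gcd[m,n]≢0 a g (inj₂ (≢-nonZero⁻¹ g)))

    c-periodic-a : Periodic a c
    c-periodic-a t =
      trans (∑-cong n (λ j _ → cong (𝟙 ∘ (g ∣?_)) (+-assoc t a (j * a))))
            (∑-periodic n (λ j → 𝟙 (g ∣? t + j * a))
              (trans (𝟙-∣-+ʳ t g∣na) (cong (𝟙 ∘ (g ∣?_)) (sym (+-identityʳ t)))))

    c-periodic-g : Periodic g c
    c-periodic-g t = ∑-cong n (λ j _ →
      trans (cong (𝟙 ∘ (g ∣?_)) (+-rotate t g (j * a))) (𝟙-∣-+ˡ (t + j * a) ∣-refl))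
      where
      +-rotate : ∀ t g b → t + g + b ≡ g + (t + b)
      +-rotate = solve-∀

    c-vanishes : ∀ t → ¬ h ∣ t → c t ≡ 0
    c-vanishes t h∤t = ∑-zero n (λ j _ → 𝟙-no (g ∣? t + j * a) (λ g∣t+ja →
      h∤t (∣m+n∣n⇒∣m (∣-trans (gcd[m,n]∣n a g) g∣t+ja) (∣n⇒∣m*n j (gcd[m,n]∣m a g)))))

    c-closedForm : ∀ t → c t ≡ 𝟙 (h ∣? t) * c 0
    c-closedForm t with h ∣? t
    ... | yes h∣t = trans (periodic-∣ (periodic-gcd c-periodic-a c-periodic-g) h∣t) (sym (*-identityˡ (c 0)))
    ... | no  h∤t = c-vanishes t h∤t

    c-total : ∑[ t < g ] c t ≡ n
    c-total = begin
      ∑[ t < g ] ∑[ j < n ] 𝟙 (g ∣? t + j * a) ≡⟨ ∑-comm g n _ ⟩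
      ∑[ j < n ] ∑[ t < g ] 𝟙 (g ∣? t + j * a) ≡⟨ ∑-cong n (λ j _ → ∑𝟙-∣-window g (j * a)) ⟩
      ∑[ j < n ] 1                             ≡⟨ ∑-1 n ⟩
      n                                        ∎
      where open ≡-Reasoning

    c0*g≡n*h : c 0 * g ≡ n * h
    c0*g≡n*h with gcd[m,n]∣n a g
    ... | divides q g≡qh = begin
      c 0 * g              ≡⟨ cong (c 0 *_) g≡qh ⟩
      c 0 * (q * h)        ≡⟨ reorder (c 0) q h ⟩
      (q * c 0) * h        ≡⟨ cong (_* h) q*c0≡n ⟩
      n * h                ∎
      where
      open ≡-Reasoning
      reorder : ∀ x q h → x * (q * h) ≡ q * x * h
      reorder = solve-∀
      q*c0≡n : q * c 0 ≡ n
      q*c0≡n = begin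
        q * c 0                          ≡⟨ cong (_* c 0) (∑𝟙-∣-multiples q h) ⟨
        (∑[ t < q * h ] 𝟙 (h ∣? t)) * c 0 ≡⟨ cong (λ m → (∑[ t < m ] 𝟙 (h ∣? t)) * c 0) g≡qh ⟨
        (∑[ t < g ] 𝟙 (h ∣? t)) * c 0     ≡⟨ ∑-distribʳ-* g _ (c 0) ⟨
        ∑[ t < g ] 𝟙 (h ∣? t) * c 0       ≡⟨ ∑-cong g (λ t _ → c-closedForm t) ⟨
        ∑[ t < g ] c t                    ≡⟨ c-total ⟩
        n                                 ∎

  countAffine-closedForm : ∀ t → countAffine n a g t * g ≡ 𝟙 (gcd a g ∣? t) * (n * gcd a g)
  countAffine-closedForm t = begin
    c t * g                  ≡⟨ cong (_* g) (c-closedForm t) ⟩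
    𝟙 (h ∣? t) * c 0 * g     ≡⟨ *-assoc (𝟙 (h ∣? t)) (c 0) g ⟩
    𝟙 (h ∣? t) * (c 0 * g)   ≡⟨ cong (𝟙 (h ∣? t) *_) c0*g≡n*h ⟩
    𝟙 (h ∣? t) * (n * h)     ∎
    where open ≡-Reasoning

-- Signed sums over sublists

∑ℤ : ℕ → (ℕ → ℤ) → ℤ
∑ℤ zero    f = ℤ.0ℤ
∑ℤ (suc n) f = f 0 ℤ.+ ∑ℤ n (f ∘ suc)

infix 5 ∑ℤ
syntax ∑ℤ n (λ j → e) = ∑ℤ[ j < n ] e

∑ℤ-cong : ∀ n {f g : ℕ → ℤ} → (∀ j → f j ≡ g j) → ∑ℤ n f ≡ ∑ℤ n g
∑ℤ-cong zero    eq = refl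
∑ℤ-cong (suc n) eq = cong₂ ℤ._+_ (eq 0) (∑ℤ-cong n (eq ∘ suc))

pos-∑ : ∀ n (f : ℕ → ℕ) → + ∑ n f ≡ ∑ℤ[ j < n ] + f j
pos-∑ zero    f = refl
pos-∑ (suc n) f = trans (ℤ.pos-+ (f 0) _) (cong (ℤ._+_ (+ f 0)) (pos-∑ n (f ∘ suc)))

∑ℤ-tail : ∀ n (f : ℕ → ℕ) → ∑ℤ[ j < n ] + f (suc j) ≡ + ∑ (suc n) f ℤ.- + f 0
∑ℤ-tail n f = begin
  ∑ℤ[ j < n ] + f (suc j)              ≡⟨ pos-∑ n (f ∘ suc) ⟨
  + ∑ n (f ∘ suc)                      ≡⟨ cancel (+ f 0) _ ⟩
  + f 0 ℤ.+ + ∑ n (f ∘ suc) ℤ.- + f 0  ≡⟨ cong (ℤ._- + f 0) (ℤ.pos-+ (f 0) _) ⟨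
  + ∑ (suc n) f ℤ.- + f 0              ∎
  where
  open ≡-Reasoning
  cancel : ∀ x y → y ≡ (x ℤ.+ y) ℤ.- x
  cancel = solveℤ-∀

∑ℤ-distribˡ-* : ∀ n c (f : ℕ → ℤ) → ∑ℤ[ j < n ] (c ℤ.* f j) ≡ c ℤ.* ∑ℤ n f
∑ℤ-distribˡ-* zero    c f = sym (ℤ.*-zeroʳ c)
∑ℤ-distribˡ-* (suc n) c f =
  trans (cong (ℤ._+_ (c ℤ.* f 0)) (∑ℤ-distribˡ-* n c (f ∘ suc))) (sym (ℤ.*-distribˡ-+ c (f 0) _))

-- ∑± f ds is the inclusion–exclusion sum of f T over the sublists T of ds,
-- with sign (-1)^(number of omitted entries).
∑± : ∀ {s} → (List ℕ → ℤ) → Vec ℕ s → ℤ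
∑± f []       = f []
∑± f (d ∷ ds) = ∑± (f ∘ (d ∷_)) ds ℤ.- ∑± f ds

∑±-congᴬ : ∀ {s} {P : ℕ → Set} {f g : List ℕ → ℤ} {ds : Vec ℕ s} → All P ds →
           (∀ T → ListAll P T → f T ≡ g T) → ∑± f ds ≡ ∑± g ds
∑±-congᴬ []         eq = eq [] []ᴬ
∑±-congᴬ (pd ∷ pds) eq =
  cong₂ ℤ._-_ (∑±-congᴬ pds (λ T pT → eq (_ ∷ T) (pd ∷ᴬ pT))) (∑±-congᴬ pds eq)

∑±-cong : ∀ {s} {f g : List ℕ → ℤ} (ds : Vec ℕ s) → (∀ T → f T ≡ g T) → ∑± f ds ≡ ∑± g ds
∑±-cong ds eq = ∑±-congᴬ {P = λ _ → ⊤} (All.universal _ ds) (λ T _ → eq T)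

∑±-+ : ∀ {s} (f g : List ℕ → ℤ) (ds : Vec ℕ s) → ∑± (λ T → f T ℤ.+ g T) ds ≡ ∑± f ds ℤ.+ ∑± g ds
∑±-+ f g []       = refl
∑±-+ f g (d ∷ ds) =
  trans (cong₂ ℤ._-_ (∑±-+ (f ∘ (d ∷_)) (g ∘ (d ∷_)) ds) (∑±-+ f g ds))
        (interchange (∑± (f ∘ (d ∷_)) ds) (∑± (g ∘ (d ∷_)) ds) (∑± f ds) (∑± g ds))
  where
  interchange : ∀ a b c d → (a ℤ.+ b) ℤ.- (c ℤ.+ d) ≡ (a ℤ.- c) ℤ.+ (b ℤ.- d)
  interchange = solveℤ-∀

∑±-- : ∀ {s} (f g : List ℕ → ℤ) (ds : Vec ℕ s) → ∑± (λ T → f T ℤ.- g T) ds ≡ ∑± f ds ℤ.- ∑± g ds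
∑±-- f g []       = refl
∑±-- f g (d ∷ ds) =
  trans (cong₂ ℤ._-_ (∑±-- (f ∘ (d ∷_)) (g ∘ (d ∷_)) ds) (∑±-- f g ds))
        (interchange (∑± (f ∘ (d ∷_)) ds) (∑± (g ∘ (d ∷_)) ds) (∑± f ds) (∑± g ds))
  where
  interchange : ∀ a b c d → (a ℤ.- b) ℤ.- (c ℤ.- d) ≡ (a ℤ.- c) ℤ.- (b ℤ.- d)
  interchange = solveℤ-∀

∑±-0 : ∀ {s} (ds : Vec ℕ s) → ∑± (λ _ → ℤ.0ℤ) ds ≡ ℤ.0ℤ
∑±-0 []       = refl
∑±-0 (d ∷ ds) = cong₂ ℤ._-_ (∑±-0 ds) (∑±-0 ds)

∑±-*ˡ : ∀ {s} c (f : List ℕ → ℤ) (ds : Vec ℕ s) → ∑± (λ T → c ℤ.* f T) ds ≡ c ℤ.* ∑± f ds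
∑±-*ˡ c f []       = refl
∑±-*ˡ c f (d ∷ ds) =
  trans (cong₂ ℤ._-_ (∑±-*ˡ c (f ∘ (d ∷_)) ds) (∑±-*ˡ c f ds)) (sym (distrib c _ _))
  where
  distrib : ∀ c a b → c ℤ.* (a ℤ.- b) ≡ c ℤ.* a ℤ.- c ℤ.* b
  distrib = solveℤ-∀

∑±-∑ℤ : ∀ {s} n (f : ℕ → List ℕ → ℤ) (ds : Vec ℕ s) →
        ∑± (λ T → ∑ℤ[ y < n ] f y T) ds ≡ ∑ℤ[ y < n ] ∑± (f y) ds
∑±-∑ℤ zero    f ds = ∑±-0 ds
∑±-∑ℤ (suc n) f ds =
  trans (∑±-+ (f 0) (λ T → ∑ℤ[ y < n ] f (suc y) T) ds) (cong (ℤ._+_ (∑± (f 0) ds)) (∑±-∑ℤ n (f ∘ suc) ds))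

divisorWeight : ℕ → List ℕ → ℕ
divisorWeight m []      = 1
divisorWeight m (d ∷ T) = 𝟙 (d ∣? m) * d * divisorWeight m T

prodDiv-expansion : ∀ {s} (ds : Vec ℕ s) m →
                    ℤ.-1ℤ ℤ.^ s ℤ.* prodDiv ds m ≡ ∑± (λ T → + divisorWeight m T) ds
prodDiv-expansion []               m = refl
prodDiv-expansion {suc s} (d ∷ ds) m = begin
  (ℤ.-1ℤ ℤ.* Y) ℤ.* (factor (d ∣? m) ℤ.* P) ≡⟨ regroup Y (factor (d ∣? m)) P ⟩
  (ℤ.-1ℤ ℤ.* factor (d ∣? m)) ℤ.* X         ≡⟨ cong (ℤ._* X) (-factor≡weight-1 (d ∣? m)) ⟩
  (+ k ℤ.- ℤ.1ℤ) ℤ.* X                      ≡⟨ distrib (+ k) X ⟩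
  + k ℤ.* X ℤ.- X                           ≡⟨ cong₂ (λ u v → + k ℤ.* u ℤ.- v) IH IH ⟩
  + k ℤ.* ∑± W ds ℤ.- ∑± W ds               ≡⟨ cong (ℤ._- ∑± W ds) (∑±-*ˡ (+ k) W ds) ⟨
  ∑± (λ T → + k ℤ.* W T) ds ℤ.- ∑± W ds     ≡⟨ cong (ℤ._- ∑± W ds) (∑±-cong ds (λ T → ℤ.pos-* k _)) ⟨
  ∑± (λ T → + (k * divisorWeight m T)) ds ℤ.- ∑± W ds ∎
  where
  open ≡-Reasoning
  Y = ℤ.-1ℤ ℤ.^ s
  P = prodDiv ds m
  X = Y ℤ.* P
  k = 𝟙 (d ∣? m) * d
  W : List ℕ → ℤ
  W T = + divisorWeight m T
  IH : X ≡ ∑± W ds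
  IH = prodDiv-expansion ds m
  factor : Dec (d ∣ m) → ℤ
  factor dec = if does dec then ℤ.1ℤ ℤ.- + d else ℤ.1ℤ
  -factor≡weight-1 : (dec : Dec (d ∣ m)) → ℤ.-1ℤ ℤ.* factor dec ≡ + (𝟙 dec * d) ℤ.- ℤ.1ℤ
  -factor≡weight-1 (yes _) = trans (negate (+ d)) (cong (λ x → + x ℤ.- ℤ.1ℤ) (sym (*-identityˡ d)))
    where
    negate : ∀ x → ℤ.-1ℤ ℤ.* (ℤ.1ℤ ℤ.- x) ≡ x ℤ.- ℤ.1ℤ
    negate = solveℤ-∀
  -factor≡weight-1 (no _)  = refl
  regroup : ∀ y c p → (ℤ.-1ℤ ℤ.* y) ℤ.* (c ℤ.* p) ≡ (ℤ.-1ℤ ℤ.* c) ℤ.* (y ℤ.* p)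
  regroup = solveℤ-∀
  distrib : ∀ a x → (a ℤ.- ℤ.1ℤ) ℤ.* x ≡ a ℤ.* x ℤ.- x
  distrib = solveℤ-∀

-- Counting modulo M

-- M / d, with the junk value 0 at d = 0 so that it can be used without a NonZero instance.
cofactor : ℕ → ℕ → ℕ
cofactor M zero    = 0
cofactor M (suc k) = M ℕ./ suc k

0∤nonZero : ∀ {M} .{{_ : NonZero M}} → ¬ 0 ∣ M
0∤nonZero {M} 0∣M = ≢-nonZero⁻¹ M (0∣⇒≡0 0∣M)

*-cofactor : ∀ {d M} .{{_ : NonZero M}} → d ∣ M → d * cofactor M d ≡ M
*-cofactor {zero}  0∣M = ⊥-elim (0∤nonZero 0∣M)
*-cofactor {suc d} d∣M = m*[n/m]≡n d∣M

cofactor-nonZero : ∀ {d M} .{{_ : NonZero M}} → d ∣ M → NonZero (cofactor M d)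
cofactor-nonZero {d} {M} d∣M = ≢-nonZero λ a≡0 →
  ≢-nonZero⁻¹ M (trans (sym (*-cofactor d∣M)) (trans (cong (d *_) a≡0) (*-zeroʳ d)))

𝟙-∣-*gcd : ∀ {d a M} g m .{{_ : NonZero a}} → d * a ≡ M →
           𝟙 (d ∣? m) * 𝟙 (M ∣? m * g) ≡ 𝟙 (M ∣? m * gcd a g)
𝟙-∣-*gcd {d} {a} g m refl = 𝟙-× (d ∣? m) (d * a ∣? m * g) (d * a ∣? m * gcd a g)
  (λ d∣m da∣mg → subst (d * a ∣_) (sym (c*gcd[m,n]≡gcd[cm,cn] m a g))
                   (gcd-greatest (*-monoˡ-∣ a d∣m) da∣mg))
  (λ da∣mh → *-cancelʳ-∣ a (∣-trans da∣mh (*-monoʳ-∣ m (gcd[m,n]∣m a g))))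
  (λ da∣mh → ∣-trans da∣mh (*-monoʳ-∣ m (gcd[m,n]∣n a g)))

∑𝟙-∣-*divisor : ∀ {M g} .{{_ : NonZero M}} .{{_ : NonZero g}} → g ∣ M → ∑[ m < M ] 𝟙 (M ∣? m * g) ≡ g
∑𝟙-∣-*divisor {g = g} (divides q refl) = begin
  ∑[ m < q * g ] 𝟙 (q * g ∣? m * g) ≡⟨ ∑-cong (q * g) (λ m _ → 𝟙-cong (q * g ∣? m * g) (q ∣? m)
                                         (*-cancelʳ-∣ g) (*-monoˡ-∣ g)) ⟩
  ∑[ m < q * g ] 𝟙 (q ∣? m)         ≡⟨ cong (λ n → ∑[ m < n ] 𝟙 (q ∣? m)) (*-comm q g) ⟩
  ∑[ m < g * q ] 𝟙 (q ∣? m)         ≡⟨ ∑𝟙-∣-multiples g q ⟩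
  g                                  ∎
  where
  open ≡-Reasoning
  instance
    q-nonZero : NonZero q
    q-nonZero = m*n≢0⇒m≢0 q

module _ (M : ℕ) .{{_ : NonZero M}} where

  -- countFull T t counts the tuples (y_d)_{d ∈ T} with 0 ≤ y_d < d and M ∣ t + ∑ y_d·(M/d);
  -- countProper restricts to 1 ≤ y_d < d.
  countFull : List ℕ → ℕ → ℕ
  countFull []      t = 𝟙 (M ∣? t)
  countFull (d ∷ T) t = ∑[ y < d ] countFull T (t + y * cofactor M d)

  countProper : ∀ {s} → Vec ℕ s → ℕ → ℕ
  countProper []       t = 𝟙 (M ∣? t)
  countProper (d ∷ ds) t = ∑[ y < d ∸ 1 ] countProper ds (t + suc y * cofactor M d)

  gcdCofactors : List ℕ → ℕ
  gcdCofactors []      = M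
  gcdCofactors (d ∷ T) = gcd (cofactor M d) (gcdCofactors T)

  gcdCofactors∣M : ∀ T → gcdCofactors T ∣ M
  gcdCofactors∣M []      = ∣-refl
  gcdCofactors∣M (d ∷ T) = ∣-trans (gcd[m,n]∣n (cofactor M d) _) (gcdCofactors∣M T)

  gcdCofactors≢0 : ∀ T → gcdCofactors T ≢ 0
  gcdCofactors≢0 []      = ≢-nonZero⁻¹ M
  gcdCofactors≢0 (d ∷ T) = gcd[m,n]≢0 (cofactor M d) _ (inj₂ (gcdCofactors≢0 T))

  countProper-inclusionExclusion : ∀ {s} {ds : Vec ℕ s} → All (_∣ M) ds → ∀ t →
                                   + countProper ds t ≡ ∑± (λ T → + countFull T t) ds
  countProper-inclusionExclusion []                              t = refl
  countProper-inclusionExclusion {ds = zero ∷ ds}  (0∣M ∷ _)     t = ⊥-elim (0∤nonZero 0∣M)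
  countProper-inclusionExclusion {ds = suc k ∷ ds} (_ ∷ ds∣M) t = begin
    + (∑[ y < k ] countProper ds (t + suc y * a))                    ≡⟨ pos-∑ k _ ⟩
    ∑ℤ[ y < k ] + countProper ds (t + suc y * a)                     ≡⟨ ∑ℤ-cong k (λ y → IH (t + suc y * a)) ⟩
    ∑ℤ[ y < k ] ∑± (λ T → + countFull T (t + suc y * a)) ds          ≡⟨ ∑±-∑ℤ k _ ds ⟨
    ∑± (λ T → ∑ℤ[ y < k ] + countFull T (t + suc y * a)) ds          ≡⟨ ∑±-cong ds omit-y=0 ⟩
    ∑± (λ T → + countFull (suc k ∷ T) t ℤ.- + countFull T t) ds      ≡⟨ ∑±-- _ _ ds ⟩
    ∑± (λ T → + countFull (suc k ∷ T) t) ds ℤ.- ∑± (λ T → + countFull T t) ds ∎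
    where
    open ≡-Reasoning
    a = cofactor M (suc k)
    IH = countProper-inclusionExclusion ds∣M
    omit-y=0 : ∀ T → ∑ℤ[ y < k ] + countFull T (t + suc y * a) ≡ + countFull (suc k ∷ T) t ℤ.- + countFull T t
    omit-y=0 T = trans (∑ℤ-tail k (λ y → countFull T (t + y * a)))
                       (cong (λ u → + countFull (suc k ∷ T) t ℤ.- + countFull T u) (+-identityʳ t))

  countFull-closedForm : ∀ {T} → ListAll (_∣ M) T → ∀ t →
                         countFull T t * M ≡ 𝟙 (gcdCofactors T ∣? t) * (product T * gcdCofactors T)
  countFull-closedForm []ᴬ t = cong (𝟙 (M ∣? t) *_) (sym (*-identityˡ M))
  countFull-closedForm {d ∷ T} (d∣M ∷ᴬ T∣M) t = begin
    (∑[ y < d ] countFull T (t + y * a)) * M              ≡⟨ ∑-distribʳ-* d _ M ⟨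
    ∑[ y < d ] countFull T (t + y * a) * M                ≡⟨ ∑-cong d (λ y _ → countFull-closedForm T∣M (t + y * a)) ⟩
    ∑[ y < d ] 𝟙 (g ∣? t + y * a) * (product T * g)       ≡⟨ ∑-distribʳ-* d _ (product T * g) ⟩
    countAffine d a g t * (product T * g)                 ≡⟨ reorder (countAffine d a g t) (product T) g ⟩
    countAffine d a g t * g * product T                   ≡⟨ cong (_* product T) (countAffine-closedForm d a g g∣da t) ⟩
    𝟙 (gcd a g ∣? t) * (d * gcd a g) * product T           ≡⟨ reorder′ (𝟙 (gcd a g ∣? t)) d (gcd a g) (product T) ⟩
    𝟙 (gcd a g ∣? t) * (d * product T * gcd a g)           ∎
    where
    open ≡-Reasoning
    a = cofactor M d
    g = gcdCofactors T
    instance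
      g-nonZero : NonZero g
      g-nonZero = ≢-nonZero (gcdCofactors≢0 T)
    g∣da : g ∣ d * a
    g∣da = subst (g ∣_) (sym (*-cofactor d∣M)) (gcdCofactors∣M T)
    reorder : ∀ c p g → c * (p * g) ≡ c * g * p
    reorder = solve-∀
    reorder′ : ∀ i d h p → i * (d * h) * p ≡ i * (d * p * h)
    reorder′ = solve-∀

  divisorWeight-closedForm : ∀ {T} → ListAll (_∣ M) T → ∀ m →
                             divisorWeight m T ≡ 𝟙 (M ∣? m * gcdCofactors T) * product T
  divisorWeight-closedForm []ᴬ m = sym (cong (_* 1) (𝟙-yes (M ∣? m * M) (n∣m*n m)))
  divisorWeight-closedForm {d ∷ T} (d∣M ∷ᴬ T∣M) m = begin
    𝟙 (d ∣? m) * d * divisorWeight m T                          ≡⟨ cong (𝟙 (d ∣? m) * d *_) (divisorWeight-closedForm T∣M m) ⟩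
    𝟙 (d ∣? m) * d * (𝟙 (M ∣? m * g) * product T)                ≡⟨ reorder (𝟙 (d ∣? m)) d (𝟙 (M ∣? m * g)) (product T) ⟩
    𝟙 (d ∣? m) * 𝟙 (M ∣? m * g) * (d * product T)                ≡⟨ cong (_* (d * product T)) (𝟙-∣-*gcd {d} {cofactor M d} g m (*-cofactor d∣M)) ⟩
    𝟙 (M ∣? m * gcd (cofactor M d) g) * (d * product T)          ∎
    where
    open ≡-Reasoning
    g = gcdCofactors T
    instance
      a-nonZero : NonZero (cofactor M d)
      a-nonZero = cofactor-nonZero d∣M
    reorder : ∀ i d j p → i * d * (j * p) ≡ i * j * (d * p)
    reorder = solve-∀

  ∑-divisorWeight : ∀ {T} → ListAll (_∣ M) T → ∑[ m < M ] divisorWeight (suc m) T ≡ gcdCofactors T * product T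
  ∑-divisorWeight {T} T∣M = begin
    ∑[ m < M ] divisorWeight (suc m) T            ≡⟨ ∑-cong M (λ m _ → divisorWeight-closedForm T∣M (suc m)) ⟩
    ∑[ m < M ] 𝟙 (M ∣? suc m * g) * product T     ≡⟨ ∑-distribʳ-* M _ (product T) ⟩
    (∑[ m < M ] 𝟙 (M ∣? suc m * g)) * product T   ≡⟨ cong (_* product T) (∑-periodic M (λ m → 𝟙 (M ∣? m * g)) M∣Mg⇔M∣0) ⟩
    (∑[ m < M ] 𝟙 (M ∣? m * g)) * product T       ≡⟨ cong (_* product T) (∑𝟙-∣-*divisor (gcdCofactors∣M T)) ⟩
    g * product T                                 ∎
    where
    open ≡-Reasoning
    g = gcdCofactors T
    instance
      g-nonZero : NonZero g
      g-nonZero = ≢-nonZero (gcdCofactors≢0 T)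
    M∣Mg⇔M∣0 : 𝟙 (M ∣? M * g) ≡ 𝟙 (M ∣? 0)
    M∣Mg⇔M∣0 = trans (𝟙-yes (M ∣? M * g) (m∣m*n g)) (sym (𝟙-yes (M ∣? 0) (M ∣0)))

  M*countFull≡∑divisorWeight : ∀ {T} → ListAll (_∣ M) T → M * countFull T 0 ≡ ∑[ m < M ] divisorWeight (suc m) T
  M*countFull≡∑divisorWeight {T} T∣M = begin
    M * countFull T 0                              ≡⟨ *-comm M (countFull T 0) ⟩
    countFull T 0 * M                              ≡⟨ countFull-closedForm T∣M 0 ⟩
    𝟙 (g ∣? 0) * (product T * g)                   ≡⟨ cong (_* (product T * g)) (𝟙-yes (g ∣? 0) (g ∣0)) ⟩
    1 * (product T * g)                            ≡⟨ trans (*-identityˡ _) (*-comm (product T) g) ⟩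
    g * product T                                  ≡⟨ ∑-divisorWeight T∣M ⟨
    ∑[ m < M ] divisorWeight (suc m) T             ∎
    where
    open ≡-Reasoning
    g = gcdCofactors T

  M*countProper≡∑prodDiv : ∀ {s} {ds : Vec ℕ s} → All (_∣ M) ds →
                           + (M * countProper ds 0) ≡ ℤ.-1ℤ ℤ.^ s ℤ.* (∑ℤ[ m < M ] prodDiv ds (suc m))
  M*countProper≡∑prodDiv {s} {ds} ds∣M = begin
    + (M * countProper ds 0)                                  ≡⟨ ℤ.pos-* M _ ⟩
    + M ℤ.* + countProper ds 0                                ≡⟨ cong (+ M ℤ.*_) (countProper-inclusionExclusion ds∣M 0) ⟩
    + M ℤ.* ∑± (λ T → + countFull T 0) ds                     ≡⟨ ∑±-*ˡ (+ M) _ ds ⟨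
    ∑± (λ T → + M ℤ.* + countFull T 0) ds                     ≡⟨ ∑±-congᴬ ds∣M (λ T T∣M →
                                                                   trans (sym (ℤ.pos-* M _)) (cong +_ (M*countFull≡∑divisorWeight T∣M))) ⟩
    ∑± (λ T → + (∑[ m < M ] divisorWeight (suc m) T)) ds      ≡⟨ ∑±-cong ds (λ T → pos-∑ M _) ⟩
    ∑± (λ T → ∑ℤ[ m < M ] + divisorWeight (suc m) T) ds       ≡⟨ ∑±-∑ℤ M _ ds ⟩
    ∑ℤ[ m < M ] ∑± (λ T → + divisorWeight (suc m) T) ds       ≡⟨ ∑ℤ-cong M (λ m → prodDiv-expansion ds (suc m)) ⟨
    ∑ℤ[ m < M ] ℤ.-1ℤ ℤ.^ s ℤ.* prodDiv ds (suc m)            ≡⟨ ∑ℤ-distribˡ-* M (ℤ.-1ℤ ℤ.^ s) (λ m → prodDiv ds (suc m)) ⟩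
    ℤ.-1ℤ ℤ.^ s ℤ.* (∑ℤ[ m < M ] prodDiv ds (suc m))          ∎
    where open ≡-Reasoning

-- Translating I and the right-hand side

length-filter-[_] : ∀ {A : Set} {P : Pred A 0ℓ} (P? : Decidable P) x → length (filter P? [ x ]) ≡ 𝟙 (P? x)
length-filter-[_] P? x with P? x
... | yes _ = refl
... | no  _ = refl

length-filter-map : ∀ {A B : Set} {P : Pred B 0ℓ} (P? : Decidable P) (h : A → B) xs →
                    length (filter P? (map h xs)) ≡ length (filter (P? ∘ h) xs)
length-filter-map P? h []       = refl
length-filter-map P? h (x ∷ xs) with P? (h x)
... | yes _ = cong suc (length-filter-map P? h xs)
... | no  _ = length-filter-map P? h xs

length-filter-++ : ∀ {A : Set} {P : Pred A 0ℓ} (P? : Decidable P) xs ys →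
                   length (filter P? (xs ++ ys)) ≡ length (filter P? xs) + length (filter P? ys)
length-filter-++ P? xs ys = trans (cong length (filter-++ P? xs ys)) (length-++ (filter P? xs))

length-filter-concatMap : ∀ {A B : Set} {P : Pred B 0ℓ} (P? : Decidable P) (h : ℕ → A → B) (xs : List A) f n →
  length (filter P? (concatMap (λ y → map (h y) xs) (applyUpTo f n))) ≡ ∑[ j < n ] length (filter (P? ∘ h (f j)) xs)
length-filter-concatMap P? h xs f zero    = refl
length-filter-concatMap P? h xs f (suc n) =
  trans (length-filter-++ P? (map (h (f 0)) xs) _)
        (cong₂ _+_ (length-filter-map P? (h (f 0)) xs) (length-filter-concatMap P? h xs (f ∘ suc) n))

toℚᵘ-/ : ∀ i k → ℚ.toℚᵘ (i / suc k) ℚᵘ.≃ mkℚᵘ i k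
toℚᵘ-/ i k = *≡* (begin
  ℚᵘ.↥ (ℚ.toℚᵘ q) ℤ.* + suc k           ≡⟨ cong₂ ℤ._*_ (ℚ.↥ᵘ-toℚᵘ q) (sym (ℚ.↧-/ i (suc k))) ⟩
  ℚ.↥ q ℤ.* (ℚ.↧ q ℤ.* ℤ.gcd i (+ suc k)) ≡⟨ regroup (ℚ.↥ q) (ℚ.↧ q) _ ⟩
  ℚ.↥ q ℤ.* ℤ.gcd i (+ suc k) ℤ.* ℚ.↧ q   ≡⟨ cong₂ ℤ._*_ (ℚ.↥-/ i (suc k)) (sym (ℚ.↧ᵘ-toℚᵘ q)) ⟩
  i ℤ.* ℚᵘ.↧ (ℚ.toℚᵘ q)                  ∎)
  where
  open ≡-Reasoning
  q = i / suc k
  regroup : ∀ a b c → a ℤ.* (b ℤ.* c) ≡ a ℤ.* c ℤ.* b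
  regroup = solveℤ-∀

denominator≡1⇒∣ : ∀ (q : ℚ) {M n} → ℚ.↥ q ℤ.* + M ≡ + n ℤ.* ℚ.↧ q → ℚ.denominatorℕ q ≡ 1 → M ∣ n
denominator≡1⇒∣ q {M} {n} cross den≡1 = divides ℤ.∣ ℚ.↥ q ∣ (begin
  n                         ≡⟨ *-identityʳ n ⟨
  n * 1                     ≡⟨ cong (n *_) den≡1 ⟨
  n * ℚ.denominatorℕ q      ≡⟨ ℤ.abs-* (+ n) (ℚ.↧ q) ⟨
  ℤ.∣ + n ℤ.* ℚ.↧ q ∣        ≡⟨ cong ℤ.∣_∣ cross ⟨
  ℤ.∣ ℚ.↥ q ℤ.* + M ∣        ≡⟨ ℤ.abs-* (ℚ.↥ q) (+ M) ⟩
  ℤ.∣ ℚ.↥ q ∣ * M            ∎)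
  where open ≡-Reasoning

∣⇒denominator≡1 : ∀ (q : ℚ) {M n} .{{_ : NonZero M}} → ℚ.↥ q ℤ.* + M ≡ + n ℤ.* ℚ.↧ q → M ∣ n → ℚ.denominatorℕ q ≡ 1
∣⇒denominator≡1 q@(ℚ.mkℚ _ _ coprime) {M} (cross) (divides k refl) =
  recompute (_ ℕ.≟ 1) (coprime (divides k (*-cancelʳ-≡ _ _ M ∣↥∣M≡kdM) , ∣-refl))
  where
  open ≡-Reasoning
  ∣↥∣M≡kdM : ℤ.∣ ℚ.↥ q ∣ * M ≡ k * ℚ.denominatorℕ q * M
  ∣↥∣M≡kdM = begin
    ℤ.∣ ℚ.↥ q ∣ * M                ≡⟨ ℤ.abs-* (ℚ.↥ q) (+ M) ⟨
    ℤ.∣ ℚ.↥ q ℤ.* + M ∣            ≡⟨ cong ℤ.∣_∣ cross ⟩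
    ℤ.∣ + (k * M) ℤ.* ℚ.↧ q ∣      ≡⟨ ℤ.abs-* (+ (k * M)) (ℚ.↧ q) ⟩
    k * M * ℚ.denominatorℕ q       ≡⟨ swap k M _ ⟩
    k * ℚ.denominatorℕ q * M       ∎
    where
    swap : ∀ a b c → a * b * c ≡ a * c * b
    swap = solve-∀

n/1≡[y/M]*[σ/1] : ∀ n y σ K → + n ℤ.* + suc K ≡ y ℤ.* σ → (+ n) / 1 ≡ (y / suc K) ℚ.* (σ / 1)
n/1≡[y/M]*[σ/1] n y σ K nM≡yσ = ℚ.toℚᵘ-injective (begin
  ℚ.toℚᵘ (+ n / 1)                             ≈⟨ toℚᵘ-/ (+ n) 0 ⟩
  mkℚᵘ (+ n) 0                                 ≈⟨ *≡* cross ⟩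
  mkℚᵘ y K ℚᵘ.* mkℚᵘ σ 0                       ≈⟨ ℚᵘ.*-cong (toℚᵘ-/ y K) (toℚᵘ-/ σ 0) ⟨
  ℚ.toℚᵘ (y / suc K) ℚᵘ.* ℚ.toℚᵘ (σ / 1)       ≈⟨ ℚ.toℚᵘ-homo-* (y / suc K) (σ / 1) ⟨
  ℚ.toℚᵘ ((y / suc K) ℚ.* (σ / 1))             ∎)
  where
  open ℚᵘ.≃-Reasoning
  cross : + n ℤ.* + (suc K * 1) ≡ y ℤ.* σ ℤ.* + 1
  cross = trans (cong (λ m → + n ℤ.* + m) (*-identityʳ (suc K))) (trans nM≡yσ (sym (ℤ.*-identityʳ (y ℤ.* σ))))

mkℚᵘ-+-commonDenominator : ∀ y N a k K → suc k * a ≡ suc K → mkℚᵘ (+ y) k ℚᵘ.+ mkℚᵘ (+ N) K ℚᵘ.≃ mkℚᵘ (+ (y * a + N)) K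
mkℚᵘ-+-commonDenominator y N a k K da≡M = *≡* (begin
  (+ y ℤ.* + M ℤ.+ + N ℤ.* + d) ℤ.* + M                          ≡⟨ cong (λ m → (+ y ℤ.* m ℤ.+ + N ℤ.* + d) ℤ.* m) M≡da ⟩
  (+ y ℤ.* (+ d ℤ.* + a) ℤ.+ + N ℤ.* + d) ℤ.* (+ d ℤ.* + a)      ≡⟨ combine (+ y) (+ N) (+ d) (+ a) ⟩
  (+ y ℤ.* + a ℤ.+ + N) ℤ.* (+ d ℤ.* (+ d ℤ.* + a))              ≡⟨ cong₂ (λ u v → (u ℤ.+ + N) ℤ.* (+ d ℤ.* v)) (ℤ.pos-* y a) M≡da ⟨
  (+ (y * a) ℤ.+ + N) ℤ.* (+ d ℤ.* + M)                          ≡⟨ cong₂ ℤ._*_ (ℤ.pos-+ (y * a) N) (ℤ.pos-* d M) ⟨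
  + (y * a + N) ℤ.* + (d * M)                                    ∎)
  where
  open ≡-Reasoning
  M = suc K
  d = suc k
  M≡da : + M ≡ + d ℤ.* + a
  M≡da = trans (cong +_ (sym da≡M)) (ℤ.pos-* d a)
  combine : ∀ y n d a → (y ℤ.* (d ℤ.* a) ℤ.+ n ℤ.* d) ℤ.* (d ℤ.* a) ≡ (y ℤ.* a ℤ.+ n) ℤ.* (d ℤ.* (d ℤ.* a))
  combine = solveℤ-∀

fracSumNumerator : ∀ {s} → ℕ → Vec ℕ s → Vec ℕ s → ℕ
fracSumNumerator M []       []       = 0
fracSumNumerator M (d ∷ ds) (y ∷ ys) = y * cofactor M d + fracSumNumerator M ds ys

toℚᵘ-fracSum : ∀ {K s} {ds ys : Vec ℕ s} → All (_∣ suc K) ds →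
               ℚ.toℚᵘ (fracSum ds ys) ℚᵘ.≃ mkℚᵘ (+ fracSumNumerator (suc K) ds ys) K
toℚᵘ-fracSum {ds = []}     {[]}     []              = *≡* refl
toℚᵘ-fracSum {ds = zero ∷ _}        (0∣M ∷ _)       = ⊥-elim (0∤nonZero 0∣M)
toℚᵘ-fracSum {K} {ds = suc k ∷ ds} {y ∷ ys} (d∣M ∷ ds∣M) = begin
  ℚ.toℚᵘ (+ y / suc k ℚ.+ fracSum ds ys)            ≈⟨ ℚ.toℚᵘ-homo-+ (+ y / suc k) (fracSum ds ys) ⟩
  ℚ.toℚᵘ (+ y / suc k) ℚᵘ.+ ℚ.toℚᵘ (fracSum ds ys)  ≈⟨ ℚᵘ.+-cong (toℚᵘ-/ (+ y) k) (toℚᵘ-fracSum ds∣M) ⟩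
  mkℚᵘ (+ y) k ℚᵘ.+ mkℚᵘ (+ N) K                    ≈⟨ mkℚᵘ-+-commonDenominator y N _ k K (*-cofactor d∣M) ⟩
  mkℚᵘ (+ (y * cofactor (suc K) (suc k) + N)) K     ∎
  where
  open ℚᵘ.≃-Reasoning
  N = fracSumNumerator (suc K) ds ys

fracSum-cross : ∀ {K s} {ds : Vec ℕ s} (ys : Vec ℕ s) → All (_∣ suc K) ds →
                ℚ.↥ (fracSum ds ys) ℤ.* + suc K ≡ + fracSumNumerator (suc K) ds ys ℤ.* ℚ.↧ (fracSum ds ys)
fracSum-cross {K} {ds = ds} ys ds∣M with toℚᵘ-fracSum {ys = ys} ds∣M
... | *≡* eq = trans (cong (ℤ._* + suc K) (sym (ℚ.↥ᵘ-toℚᵘ q)))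
                     (trans eq (cong (+ fracSumNumerator (suc K) ds ys ℤ.*_) (ℚ.↧ᵘ-toℚᵘ q)))
  where q = fracSum ds ys

length-filter-tuples : ∀ {M s} .{{_ : NonZero M}} {ds : Vec ℕ s} → All (_∣ M) ds → ∀ t →
  length (filter (λ ys → M ∣? t + fracSumNumerator M ds ys) (tuples ds)) ≡ countProper M ds t
length-filter-tuples {M} {ds = []} [] t =
  trans (length-filter-[ (λ ys → M ∣? t + fracSumNumerator M [] ys) ] []) (cong (𝟙 ∘ (M ∣?_)) (+-identityʳ t))
length-filter-tuples {ds = zero ∷ _} (0∣M ∷ _) t = ⊥-elim (0∤nonZero 0∣M)
length-filter-tuples {M} {ds = suc k ∷ ds} (_ ∷ ds∣M) t = begin
  length (filter P? (concatMap (λ y → map (y ∷_) (tuples ds)) (map suc (upTo k))))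
    ≡⟨ cong (length ∘ filter P?) (concatMap-map (λ y → map (y ∷_) (tuples ds)) suc (upTo k)) ⟩
  length (filter P? (concatMap (λ y → map (suc y ∷_) (tuples ds)) (upTo k)))
    ≡⟨ length-filter-concatMap P? (λ y → suc y ∷_) (tuples ds) (λ j → j) k ⟩
  ∑[ j < k ] length (filter (λ ys → P? (suc j ∷ ys)) (tuples ds))
    ≡⟨ ∑-cong k (λ j _ → cong length (filter-≐ _ _ (reassociate j) (tuples ds))) ⟩
  ∑[ j < k ] length (filter (λ ys → M ∣? (t + suc j * a) + fracSumNumerator M ds ys) (tuples ds))
    ≡⟨ ∑-cong k (λ j _ → length-filter-tuples ds∣M (t + suc j * a)) ⟩
  ∑[ j < k ] countProper M ds (t + suc j * a) ∎
  where
  open ≡-Reasoning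
  a = cofactor M (suc k)
  P? = λ ys → M ∣? t + fracSumNumerator M (suc k ∷ ds) ys
  reassociate : ∀ j → (λ ys → M ∣ t + (suc j * a + fracSumNumerator M ds ys))
                    ≐ (λ ys → M ∣ (t + suc j * a) + fracSumNumerator M ds ys)
  reassociate j = (λ {ys} → subst (M ∣_) (sym (+-assoc t _ (fracSumNumerator M ds ys))))
                , (λ {ys} → subst (M ∣_) (+-assoc t _ (fracSumNumerator M ds ys)))

I≡countProper : ∀ {K s} {ds : Vec ℕ s} → All (_∣ suc K) ds → I ds ≡ countProper (suc K) ds 0
I≡countProper {K} {ds = ds} ds∣M =
  trans (cong length (filter-≐ _ _ (den≡1⇒M∣N , M∣N⇒den≡1) (tuples ds))) (length-filter-tuples ds∣M 0)
  where
  den≡1⇒M∣N : ∀ {ys} → ℚ.denominatorℕ (fracSum ds ys) ≡ 1 → suc K ∣ fracSumNumerator (suc K) ds ys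
  den≡1⇒M∣N {ys} = denominator≡1⇒∣ (fracSum ds ys) (fracSum-cross ys ds∣M)
  M∣N⇒den≡1 : ∀ {ys} → suc K ∣ fracSumNumerator (suc K) ds ys → ℚ.denominatorℕ (fracSum ds ys) ≡ 1
  M∣N⇒den≡1 {ys} = ∣⇒denominator≡1 (fracSum ds ys) (fracSum-cross ys ds∣M)

foldr-map-applyUpTo : ∀ (f : ℕ → ℤ) g n → foldr ℤ._+_ ℤ.0ℤ (map f (applyUpTo g n)) ≡ ∑ℤ[ j < n ] f (g j)
foldr-map-applyUpTo f g zero    = refl
foldr-map-applyUpTo f g (suc n) = cong (ℤ._+_ (f (g 0))) (foldr-map-applyUpTo f (g ∘ suc) n)

lcm≢0 : ∀ {m n} → m ≢ 0 → n ≢ 0 → lcm m n ≢ 0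
lcm≢0 {m} {n} m≢0 n≢0 lcm≡0 with m*n≡0⇒m≡0∨n≡0 m (trans (sym (gcd*lcm m n)) (trans (cong (gcd m n *_) lcm≡0) (*-zeroʳ (gcd m n))))
... | inj₁ m≡0 = m≢0 m≡0
... | inj₂ n≡0 = n≢0 n≡0

lcmV≢0 : ∀ {s} {ds : Vec ℕ s} → All (1 ≤_) ds → lcmV ds ≢ 0
lcmV≢0 []           ()
lcmV≢0 (1≤d ∷ 1≤ds) = lcm≢0 (>⇒≢ 1≤d) (lcmV≢0 1≤ds)

∣lcmV : ∀ {s} (ds : Vec ℕ s) → All (_∣ lcmV ds) ds
∣lcmV []       = []
∣lcmV (d ∷ ds) = m∣lcm[m,n] d (lcmV ds) ∷ All.map (λ d∣D → ∣-trans d∣D (n∣lcm[m,n] d (lcmV ds))) (∣lcmV ds)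

lemma5p2 : (s : ℕ) (ds : Vec ℕ s) → (∀ i → 1 ≤ lookup ds i) →
           (+ I ds) / 1 ≡ rhs ds
lemma5p2 s ds ds≥1 with lcmV ds | lcmV≢0 {ds = ds} (lookup⁻ ds≥1) | ∣lcmV ds
... | zero  | D≢0 | _    = ⊥-elim (D≢0 refl)
... | suc K | _   | ds∣D = n/1≡[y/M]*[σ/1] (I ds) Y _ K (begin
  + I ds ℤ.* + suc K                                    ≡⟨ ℤ.pos-* (I ds) (suc K) ⟨
  + (I ds * suc K)                                      ≡⟨ cong +_ (*-comm (I ds) (suc K)) ⟩
  + (suc K * I ds)                                      ≡⟨ cong (λ n → + (suc K * n)) (I≡countProper ds∣D) ⟩
  + (suc K * countProper (suc K) ds 0)                  ≡⟨ M*countProper≡∑prodDiv (suc K) ds∣D ⟩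
  Y ℤ.* (∑ℤ[ m < suc K ] prodDiv ds (suc m))            ≡⟨ cong (Y ℤ.*_) (foldr-map-applyUpTo (prodDiv ds ∘ suc) (λ m → m) (suc K)) ⟨
  Y ℤ.* sumProdTo (suc K)                               ∎)
  where
  open ≡-Reasoning
  Y = ℤ.-1ℤ ℤ.^ s
  sumProdTo : ℕ → ℤ
  sumProdTo D = foldr ℤ._+_ ℤ.0ℤ (map (λ m → prodDiv ds (suc m)) (upTo D))
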